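{- If a region $R$ of the hexagonal grid $H$ has a signed tiling by stones, bones, and snakes, then its boundary matrix $M(R,v)$ equals $I$ or $-I$ (where $I$ is the $2\times 2$ identity matrix), for any vertex $v$ on the boundary of $R$. In particular, $M(R,v)=\pm I$ is a necessary condition for $R$ to be signed tilable by stones, bones, and snakes.
   Context: Let $H$ be the regular hexagonal tiling of the plane, drawn so that every hexagon has a horizontal top edge and a horizontal bottom edge; every edge of $H$ is then horizontal, or runs southwest–northeast, or runs southeast–northwest. Orient and label the edges: each southwest–northeast edge is oriented northeast and labeled $\alpha$; each southeast–northwest edge is oriented northwest and labeled $\beta$; each horizontal edge is oriented westward and labeled $\gamma$. Let $\omega$ be a primitive cube root of unity and set $\alpha = \begin{bmatrix}\omega^7 & 0\\ 0 & \omega^5\end{bmatrix}$, $\beta = \begin{bmatrix}\omega^7 & \omega^3\\ 0 & \omega^5\end{bmatrix}$, $\gamma = \begin{bmatrix}\omega^5 & 0\\ \omega^3 & \omega^7\end{bmatrix}$. Traversing an edge in the direction of its orientation contributes its matrix; traversing it against its orientation contributes the inverse matrix. A region is a finite, connected, simply connected union of hexagons of $H$ whose boundary is a single closed loop in $H$. For a region $R$ and a vertex $v$ on its boundary, traverse the boundary of $R$ once counterclockwise starting and ending at $v$, meeting edges $e_1,\dots,e_n$ in order with contributed matrices $M_1,\dots,M_n$, and set $M(R,v)=M_n\cdots M_1$. Identify hexagons with their centers; let $u,w$ denote vectors from a hexagon center to an adjacent (edge-sharing) hexagon center. A bone is three hexagons with centers $p,p+u,p+2u$; a stone is three hexagons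 sharing a common vertex (centers $p,p+u,p+w$, $u,w$ at angle $60^\circ$); a snake is four hexagons with centers $p,p+u,p+u+w,p+2u+w$, $u,w$ at angle $60^\circ$ (an "S" shape). A signed tiling of a region $R$ is a finite collection of tiles (stones, bones, snakes), each assigned weight $+1$ or $-1$, such that for every hexagon $h$ of $H$ the sum of the weights of the tiles containing $h$ is $1$ if $h\subseteq R$ and $0$ otherwise. -}

module Defs where

open import Data.Bool using (Bool; true; false; if_then_else_)
open import Data.Nat using (ℕ; zero; suc)
open import Data.Integer using (ℤ; +_; -[1+_]; _+_; _-_; _*_; -_; 0ℤ; 1ℤ; -1ℤ)
open import Data.Integer.Divisibility using (_∣_)
open import Data.Fin using (Fin; zero; suc)
open import Data.Product using (_×_; _,_; Σ; ∃)
open import Data.Sum using (_⊎_)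
open import Data.List using (List; []; _∷_)
open import Data.List.Membership.Propositional using (_∈_; _∉_)
open import Data.List.Relation.Unary.Any using (Any; any?)
open import Data.List.Relation.Unary.Unique.Propositional using (Unique)
open import Data.Sign using (Sign)
open import Relation.Nullary using (¬_; does)
open import Relation.Binary.PropositionalEquality using (_≡_; _≢_; refl)
open import Relation.Binary.Construct.Closure.ReflexiveTransitive using (Star)
import Data.Integer.Properties as ℤP
open import Data.Product.Properties using (≡-dec)

-- The ring ℤ[ω] = ℤ[x]/(x⁴ - x² + 1), ω = class of x, a primitive 12th
-- root of unity (with a primitive CUBE root of unity the
-- statement is false, e.g. for a single stone; the exponents 7, 5, 3 in
-- the paper only make sense for a 12th root).
-- cyc a b c d represents a + b ω + c ω² + d ω³.

record Cyc : Set where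
  constructor cyc
  field
    c0 c1 c2 c3 : ℤ

infixl 6 _⊕_
infixl 7 _⊗_

_⊕_ : Cyc → Cyc → Cyc
cyc a b c d ⊕ cyc a' b' c' d' = cyc (a + a') (b + b') (c + c') (d + d')

-- polynomial product, reduced with ω⁴ = ω² - 1, ω⁵ = ω³ - ω, ω⁶ = -1
_⊗_ : Cyc → Cyc → Cyc
cyc a b c d ⊗ cyc a' b' c' d' =
  let p0 = a * a'
      p1 = a * b' + b * a'
      p2 = a * c' + b * b' + c * a'
      p3 = a * d' + b * c' + c * b' + d * a'
      p4 = b * d' + c * c' + d * b'
      p5 = c * d' + d * c'
      p6 = d * d'
  in cyc (p0 - p4 - p6) (p1 - p5) (p2 + p4) (p3 + p5)

⊖_ : Cyc → Cyc
⊖ cyc a b c d = cyc (- a) (- b) (- c) (- d)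

e0 e1 ω : Cyc
e0 = cyc 0ℤ 0ℤ 0ℤ 0ℤ
e1 = cyc 1ℤ 0ℤ 0ℤ 0ℤ
ω  = cyc 0ℤ 1ℤ 0ℤ 0ℤ

ω^ : ℕ → Cyc
ω^ zero    = e1
ω^ (suc n) = ω ⊗ ω^ n

record M2 : Set where
  constructor mat
  field
    m11 m12 m21 m22 : Cyc

_·_ : M2 → M2 → M2
mat a b c d · mat a' b' c' d' =
  mat (a ⊗ a' ⊕ b ⊗ c') (a ⊗ b' ⊕ b ⊗ d')
      (c ⊗ a' ⊕ d ⊗ c') (c ⊗ b' ⊕ d ⊗ d')

I -I : M2
I  = mat e1 e0 e0 e1
-I = mat (⊖ e1) e0 e0 (⊖ e1)

-- the adjugate; this is the inverse for matrices of determinant 1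
-- (all three edge matrices have determinant ω¹² = 1, see the checks below)
adj : M2 → M2
adj (mat a b c d) = mat d (⊖ b) (⊖ c) a

det : M2 → Cyc
det (mat a b c d) = a ⊗ d ⊕ ⊖ (b ⊗ c)

α β γ : M2
α = mat (ω^ 7) e0 e0 (ω^ 5)
β = mat (ω^ 7) (ω^ 3) e0 (ω^ 5)
γ = mat (ω^ 5) e0 (ω^ 3) (ω^ 7)

ω-12 : ω^ 12 ≡ e1
ω-12 = refl
ω-prim : (ω^ 4 ≢ e1) × (ω^ 6 ≢ e1)
ω-prim = (λ ()) , (λ ())
α-inv : (α · adj α ≡ I) × (adj α · α ≡ I)
α-inv = refl , refl
β-inv : (β · adj β ≡ I) × (adj β · β ≡ I)
β-inv = refl , refl
γ-inv : (γ · adj γ ≡ I) × (adj γ · γ ≡ I)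
γ-inv = refl , refl

-- Points of the plane are encoded by integer pairs (x , y) standing for the
-- real point (x/2 , y·√3/2).  Hexagons have side 1, horizontal top/bottom
-- edges.  The hexagon with axial coordinates (q , r) has centre
-- (3q , q + 2r); its neighbours are at axial offsets given by `hdir`.

Pt : Set
Pt = ℤ × ℤ

Hex : Set
Hex = ℤ × ℤ

infixl 6 _+ᵖ_
_+ᵖ_ : Pt → Pt → Pt
(a , b) +ᵖ (c , d) = (a + c , b + d)

center : Hex → Pt
center (q , r) = (+ 3 * q , q + + 2 * r)

IsVertex : Pt → Set
IsVertex (x , y) = (+ 2 ∣ (x + y)) × ¬ (+ 3 ∣ x)

data Dir : Set where
  E W NE SW NW SE : Dir

vec : Dir → Pt
vec E  = (+ 2 , 0ℤ)
vec W  = (-[1+ 1 ] , 0ℤ)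
vec NE = (1ℤ , 1ℤ)
vec SW = (-1ℤ , -1ℤ)
vec NW = (-1ℤ , 1ℤ)
vec SE = (1ℤ , -1ℤ)

edgeMat : Dir → M2
edgeMat NE = α
edgeMat SW = adj α
edgeMat NW = β
edgeMat SE = adj β
edgeMat W  = γ
edgeMat E  = adj γ

-- centre of the hexagon on the left (resp. right) of the directed edge
-- from p to p + vec d
leftOff rightOff : Dir → Pt
leftOff E  = (1ℤ , 1ℤ)
leftOff W  = (-1ℤ , -1ℤ)
leftOff NE = (-1ℤ , 1ℤ)
leftOff SW = (1ℤ , -1ℤ)
leftOff NW = (-[1+ 1 ] , 0ℤ)
leftOff SE = (+ 2 , 0ℤ)
rightOff E  = (1ℤ , -1ℤ)
rightOff W  = (-1ℤ , 1ℤ)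
rightOff NE = (+ 2 , 0ℤ)
rightOff SW = (-[1+ 1 ] , 0ℤ)
rightOff NW = (1ℤ , 1ℤ)
rightOff SE = (-1ℤ , -1ℤ)

CenterIn : List Hex → Pt → Set
CenterIn R c = Any (λ h → center h ≡ c) R

-- axial neighbour offsets, in counterclockwise order (consecutive ones at 60°)
hdir : Fin 6 → Hex
hdir zero                               = (1ℤ , 0ℤ)
hdir (suc zero)                         = (0ℤ , 1ℤ)
hdir (suc (suc zero))                   = (-1ℤ , 1ℤ)
hdir (suc (suc (suc zero)))             = (-1ℤ , 0ℤ)
hdir (suc (suc (suc (suc zero))))       = (0ℤ , -1ℤ)
hdir (suc (suc (suc (suc (suc zero))))) = (1ℤ , -1ℤ)

rot+ rot- : Fin 6 → Fin 6
rot+ zero                               = suc zero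
rot+ (suc zero)                         = suc (suc zero)
rot+ (suc (suc zero))                   = suc (suc (suc zero))
rot+ (suc (suc (suc zero)))             = suc (suc (suc (suc zero)))
rot+ (suc (suc (suc (suc zero))))       = suc (suc (suc (suc (suc zero))))
rot+ (suc (suc (suc (suc (suc zero))))) = zero
rot- zero                               = suc (suc (suc (suc (suc zero))))
rot- (suc zero)                         = zero
rot- (suc (suc zero))                   = suc zero
rot- (suc (suc (suc zero)))             = suc (suc zero)
rot- (suc (suc (suc (suc zero))))       = suc (suc (suc zero))
rot- (suc (suc (suc (suc (suc zero))))) = suc (suc (suc (suc zero)))

Adjacent : Hex → Hex → Set
Adjacent h h' = ∃ λ i → h' ≡ h +ᵖ hdir i

Connected : List Hex → Set
Connected R = ∀ h h' → h ∈ R → h' ∈ R →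
  Star (λ a b → a ∈ R × b ∈ R × Adjacent a b) h h'

-- R is simply connected: (for a finite union of hexagons) its complement
-- in the plane is connected, i.e. any two hexagons outside R are joined by
-- a chain of edge-adjacent hexagons outside R
SimplyConnected : List Hex → Set
SimplyConnected R = ∀ h h' → h ∉ R → h' ∉ R →
  Star (λ a b → a ∉ R × b ∉ R × Adjacent a b) h h'

steps : Pt → List Dir → List (Pt × Dir)
steps v []       = []
steps v (d ∷ ds) = (v , d) ∷ steps (v +ᵖ vec d) ds

endpoint : Pt → List Dir → Pt
endpoint v []       = v
endpoint v (d ∷ ds) = endpoint (v +ᵖ vec d) ds

starts : Pt → List Dir → List Pt
starts v []       = []
starts v (d ∷ ds) = v ∷ starts (v +ᵖ vec d) ds

BoundaryEdgeLeft : List Hex → Pt × Dir → Set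
BoundaryEdgeLeft R (p , d) =
  IsVertex p × IsVertex (p +ᵖ vec d) ×
  CenterIn R (p +ᵖ leftOff d) × ¬ CenterIn R (p +ᵖ rightOff d)

record CCWBoundary (R : List Hex) (v : Pt) (ds : List Dir) : Set where
  field
    nonempty : ds ≢ []
    closed   : endpoint v ds ≡ v
    simple   : Unique (starts v ds)
    onBdry   : ∀ {e} → e ∈ steps v ds → BoundaryEdgeLeft R e
    complete : ∀ e → BoundaryEdgeLeft R e → e ∈ steps v ds

walkMat : List Dir → M2
walkMat []       = I
walkMat (d ∷ ds) = walkMat ds · edgeMat d

_≟ₕ_ : (h h' : Hex) → Relation.Nullary.Dec (h ≡ h')
_≟ₕ_ = ≡-dec ℤP._≟_ ℤP._≟_

-- bone  p, p+u, p+2u ;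
-- stone p, p+u, p+w ;  snake p, p+u, p+u+w, p+2u+w   with w = u rotated by ±60°
data Tile : Set where
  bone  : Hex → Fin 6 → Tile
  stone : Hex → Fin 6 → Bool → Tile
  snake : Hex → Fin 6 → Bool → Tile

turn : Bool → Fin 6 → Fin 6
turn true  = rot+
turn false = rot-

cells : Tile → List Hex
cells (bone p i) =
  p ∷ (p +ᵖ hdir i) ∷ (p +ᵖ hdir i +ᵖ hdir i) ∷ []
cells (stone p i b) =
  p ∷ (p +ᵖ hdir i) ∷ (p +ᵖ hdir (turn b i)) ∷ []
cells (snake p i b) =
  p ∷ (p +ᵖ hdir i) ∷ (p +ᵖ hdir i +ᵖ hdir (turn b i))
    ∷ (p +ᵖ hdir i +ᵖ hdir i +ᵖ hdir (turn b i)) ∷ []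

weight : Sign → ℤ
weight Sign.+ = 1ℤ
weight Sign.- = -1ℤ

coverage : List (Sign × Tile) → Hex → ℤ
coverage []            h = 0ℤ
coverage ((s , t) ∷ T) h =
  (if does (any? (h ≟ₕ_) (cells t)) then weight s else 0ℤ) + coverage T h

SignedTilable : List Hex → Set
SignedTilable R = Σ (List (Sign × Tile)) λ T →
  ∀ h → (h ∈ R → coverage T h ≡ 1ℤ) × (h ∉ R → coverage T h ≡ 0ℤ)

stoneWord : List Dir
stoneWord = SE ∷ E ∷ NE ∷ E ∷ NE ∷ NW ∷ W ∷ NW ∷ W ∷ SW ∷ SE ∷ SW ∷ []

stone-check : walkMat stoneWord ≡ -I
stone-check = refl

{-# OPTIONS --safe #-}
module Submission where

-- After a change of gauge by matrices that depend only on the coordinates of a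
-- vertex modulo 3, every edge of H carries an element of a quaternion group Q₈,
-- so M(R,v) is conjugate to a product in Q₈.  Such a product is ±1 exactly when
-- its image in Q₈/{±1} ≅ (ℤ/2)² vanishes, and that image is a sum over the
-- edges of ∂R.  Modulo 2 this sum equals the sum over the hexagons of R of
-- their own boundary sums (interior edges are counted twice), and a hexagon
-- contributes the non-zero element of (ℤ/2)² indexed by its colour in the
-- 3-colouring of H.  A signed tiling covers exactly the hexagons of R an odd
-- number of times, and each bone, stone and snake has total zero.

open import Defs
open import Data.List using (List)
open import Data.Sum using (_⊎_)
open import Relation.Binary.PropositionalEquality using (_≡_)

open import Algebra.Bundles using (CommutativeRing)
open import Data.Bool using (Bool; true; false; not; _xor_; _∧_; _∨_; if_then_else_)
open import Data.Bool.Properties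
  using (not-involutive; not-distribˡ-xor; xor-∧-commutativeRing; xor-assoc; xor-comm;
         xor-identityʳ; ∧-distribʳ-xor; ¬-not)
  renaming (_≟_ to _≟ᵇ_)
open import Algebra.Properties.CommutativeSemigroup
  (CommutativeRing.+-commutativeSemigroup xor-∧-commutativeRing) using (interchange)
open import Data.Fin using (#_)
open import Data.Fin.Properties using (all?)
open import Data.Integer using (ℤ; +_; -[1+_]; _+_; _*_; -_; pred; 0ℤ; 1ℤ; -1ℤ)
  renaming (suc to sucℤ)
import Data.Integer.Properties as ℤ
open import Data.Integer.DivMod using (_%ℕ_; _/ℕ_; n%ℕd<d; a≡a%ℕn+[a/ℕn]*n)
open import Data.Integer.Divisibility using () renaming (_∣_ to _∣ᵤ_)
open import Data.Integer.Divisibility.Signed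
  using (_∣_; _∣?_; ∣⇒∣ᵤ; ∣ᵤ⇒∣; ∣-refl; ∣n⇒∣m*n; ∣m⇒∣m*n; ∣m∣n⇒∣m+n; ∣m+n∣m⇒∣n)
open import Data.Integer.Solver using (module +-*-Solver)
open import Data.Integer.Tactic.RingSolver using (solve-∀)
open import Data.List using ([]; _∷_; _++_; map; concatMap; cartesianProduct; deduplicate)
open import Data.List.Membership.Propositional using (_∈_; _∉_; find)
open import Data.List.Membership.Propositional.Properties
  using (∈-++⁺ˡ; ∈-++⁺ʳ; ∈-++⁻; ∈-map⁻; ∈-cartesianProduct⁺; ∈-deduplicate⁺; ∈-deduplicate⁻)
import Data.List.Membership.DecPropositional as DecMembership
import Data.List.Relation.Unary.All as All
open import Data.List.Relation.Unary.All.Properties using (All¬⇒¬Any)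
open import Data.List.Relation.Unary.Any using (here; there; any?)
import Data.List.Relation.Unary.Any as Any
import Data.List.Relation.Unary.Any.Properties as Anyₚ
open import Data.List.Relation.Unary.Unique.Propositional using (Unique; []; _∷_)
import Data.List.Relation.Unary.Unique.Propositional.Properties as Unique
open import Data.List.Relation.Unary.Unique.DecPropositional.Properties using (deduplicate-!)
open import Data.List.Relation.Unary.Unique.DecPropositional _≟ₕ_ using (unique?)
import Data.Nat as ℕ
open import Data.Nat using (ℕ; zero; suc; s≤s)
open import Data.Product using (_×_; _,_; proj₁; proj₂; ∃)
open import Data.Product.Properties using (≡-dec)
open import Data.Sign using (Sign)
open import Data.Sum using (inj₁; inj₂; [_,_]′)
open import Data.Vec using (Vec; []; _∷_)
open import Function using (_∘_)
open import Function.Bundles using (mk⇔)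
open import Relation.Binary.Definitions using (DecidableEquality)
open import Relation.Binary.PropositionalEquality
  using (_≢_; refl; sym; trans; cong; cong₂; subst; subst₂; module ≡-Reasoning)
open import Relation.Nullary using (¬_; Dec; does; yes; no)
open import Relation.Nullary.Decidable
  using (True; False; map′; _×-dec_; _→-dec_; ¬?; from-yes; toWitness; toWitnessFalse;
         does-⇔; dec-true; dec-false)

cyc-cong : ∀ {a a′ b b′ c c′ d d′} → a ≡ a′ → b ≡ b′ → c ≡ c′ → d ≡ d′ →
  cyc a b c d ≡ cyc a′ b′ c′ d′
cyc-cong refl refl refl refl = refl

mat-cong : ∀ {a a′ b b′ c c′ d d′} → a ≡ a′ → b ≡ b′ → c ≡ c′ → d ≡ d′ →
  mat a b c d ≡ mat a′ b′ c′ d′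
mat-cong refl refl refl refl = refl

-- _⊕ᴾ_ and _⊗ᴾ_ repeat the clauses of _⊕_ and _⊗_ on the syntax of the ring
-- solver, so ⟦ p ⊗ᴾ q ⟧ᶜ ρ reduces to ⟦ p ⟧ᶜ ρ ⊗ ⟦ q ⟧ᶜ ρ: an identity of
-- ℤ[ω] in four variables becomes four polynomial identities over ℤ.
module CycSolver where
  open +-*-Solver using (Polynomial; var; con; _:+_; _:*_; _:-_; ⟦_⟧; ⟦_⟧↓; prove)

  record CycPoly : Set where
    constructor cycP
    field p₀ p₁ p₂ p₃ : Polynomial 16

  infixl 6 _⊕ᴾ_
  infixl 7 _⊗ᴾ_

  _⊕ᴾ_ _⊗ᴾ_ : CycPoly → CycPoly → CycPoly
  cycP a b c d ⊕ᴾ cycP a′ b′ c′ d′ = cycP (a :+ a′) (b :+ b′) (c :+ c′) (d :+ d′)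
  cycP a b c d ⊗ᴾ cycP a′ b′ c′ d′ =
    let p0 = a :* a′
        p1 = a :* b′ :+ b :* a′
        p2 = a :* c′ :+ b :* b′ :+ c :* a′
        p3 = a :* d′ :+ b :* c′ :+ c :* b′ :+ d :* a′
        p4 = b :* d′ :+ c :* c′ :+ d :* b′
        p5 = c :* d′ :+ d :* c′
        p6 = d :* d′
    in cycP (p0 :- p4 :- p6) (p1 :- p5) (p2 :+ p4) (p3 :+ p5)

  e0ᴾ e1ᴾ : CycPoly
  e0ᴾ = cycP (con (+ 0)) (con (+ 0)) (con (+ 0)) (con (+ 0))
  e1ᴾ = cycP (con (+ 1)) (con (+ 0)) (con (+ 0)) (con (+ 0))

  Wᴾ Xᴾ Yᴾ Zᴾ : CycPoly
  Wᴾ = cycP (var (# 0)) (var (# 1)) (var (# 2)) (var (# 3))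
  Xᴾ = cycP (var (# 4)) (var (# 5)) (var (# 6)) (var (# 7))
  Yᴾ = cycP (var (# 8)) (var (# 9)) (var (# 10)) (var (# 11))
  Zᴾ = cycP (var (# 12)) (var (# 13)) (var (# 14)) (var (# 15))

  ⟦_⟧ᶜ : CycPoly → Vec ℤ 16 → Cyc
  ⟦ cycP a b c d ⟧ᶜ ρ = cyc (⟦ a ⟧ ρ) (⟦ b ⟧ ρ) (⟦ c ⟧ ρ) (⟦ d ⟧ ρ)

  env : Cyc → Cyc → Cyc → Cyc → Vec ℤ 16
  env (cyc a b c d) (cyc e f g h) (cyc i j k l) (cyc m n o p) =
    a ∷ b ∷ c ∷ d ∷ e ∷ f ∷ g ∷ h ∷ i ∷ j ∷ k ∷ l ∷ m ∷ n ∷ o ∷ p ∷ []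

  by-ring : ∀ (p q : CycPoly) (ρ : Vec ℤ 16) → let open CycPoly in
    ⟦ p₀ p ⟧↓ ρ ≡ ⟦ p₀ q ⟧↓ ρ → ⟦ p₁ p ⟧↓ ρ ≡ ⟦ p₁ q ⟧↓ ρ →
    ⟦ p₂ p ⟧↓ ρ ≡ ⟦ p₂ q ⟧↓ ρ → ⟦ p₃ p ⟧↓ ρ ≡ ⟦ p₃ q ⟧↓ ρ → ⟦ p ⟧ᶜ ρ ≡ ⟦ q ⟧ᶜ ρ
  by-ring (cycP a b c d) (cycP a′ b′ c′ d′) ρ e₀ e₁ e₂ e₃ =
    cyc-cong (prove ρ a a′ e₀) (prove ρ b b′ e₁) (prove ρ c c′ e₂) (prove ρ d d′ e₃)

open CycSolver using (by-ring; env; Wᴾ; Xᴾ; Yᴾ; Zᴾ; e0ᴾ; e1ᴾ; _⊕ᴾ_; _⊗ᴾ_)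

⊕-interchange : ∀ w x y z → (w ⊕ x) ⊕ (y ⊕ z) ≡ (w ⊕ y) ⊕ (x ⊕ z)
⊕-interchange w x y z =
  by-ring ((Wᴾ ⊕ᴾ Xᴾ) ⊕ᴾ (Yᴾ ⊕ᴾ Zᴾ)) ((Wᴾ ⊕ᴾ Yᴾ) ⊕ᴾ (Xᴾ ⊕ᴾ Zᴾ)) (env w x y z) refl refl refl refl

⊗-assoc : ∀ x y z → (x ⊗ y) ⊗ z ≡ x ⊗ (y ⊗ z)
⊗-assoc x y z =
  by-ring ((Xᴾ ⊗ᴾ Yᴾ) ⊗ᴾ Zᴾ) (Xᴾ ⊗ᴾ (Yᴾ ⊗ᴾ Zᴾ)) (env e0 x y z) refl refl refl refl

⊗-distribˡ : ∀ x y z → x ⊗ (y ⊕ z) ≡ x ⊗ y ⊕ x ⊗ z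
⊗-distribˡ x y z =
  by-ring (Xᴾ ⊗ᴾ (Yᴾ ⊕ᴾ Zᴾ)) (Xᴾ ⊗ᴾ Yᴾ ⊕ᴾ Xᴾ ⊗ᴾ Zᴾ) (env e0 x y z) refl refl refl refl

⊗-distribʳ : ∀ x y z → (x ⊕ y) ⊗ z ≡ x ⊗ z ⊕ y ⊗ z
⊗-distribʳ x y z =
  by-ring ((Xᴾ ⊕ᴾ Yᴾ) ⊗ᴾ Zᴾ) (Xᴾ ⊗ᴾ Zᴾ ⊕ᴾ Yᴾ ⊗ᴾ Zᴾ) (env e0 x y z) refl refl refl refl

·-assoc : ∀ A B C → (A · B) · C ≡ A · (B · C)
·-assoc (mat a b c d) (mat a′ b′ c′ d′) (mat a″ b″ c″ d″) =
  mat-cong (entry a b a′ c′ b′ d′ a″ c″) (entry a b a′ c′ b′ d′ b″ d″)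
           (entry c d a′ c′ b′ d′ a″ c″) (entry c d a′ c′ b′ d′ b″ d″)
  where
  open ≡-Reasoning
  entry : ∀ x z y w y′ w′ u u′ → (x ⊗ y ⊕ z ⊗ w) ⊗ u ⊕ (x ⊗ y′ ⊕ z ⊗ w′) ⊗ u′
                                ≡ x ⊗ (y ⊗ u ⊕ y′ ⊗ u′) ⊕ z ⊗ (w ⊗ u ⊕ w′ ⊗ u′)
  entry x z y w y′ w′ u u′ = begin
    (x ⊗ y ⊕ z ⊗ w) ⊗ u ⊕ (x ⊗ y′ ⊕ z ⊗ w′) ⊗ u′
      ≡⟨ cong₂ _⊕_ (⊗-distribʳ (x ⊗ y) (z ⊗ w) u) (⊗-distribʳ (x ⊗ y′) (z ⊗ w′) u′) ⟩
    (x ⊗ y) ⊗ u ⊕ (z ⊗ w) ⊗ u ⊕ ((x ⊗ y′) ⊗ u′ ⊕ (z ⊗ w′) ⊗ u′)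
      ≡⟨ ⊕-interchange ((x ⊗ y) ⊗ u) ((z ⊗ w) ⊗ u) ((x ⊗ y′) ⊗ u′) ((z ⊗ w′) ⊗ u′) ⟩
    ((x ⊗ y) ⊗ u ⊕ (x ⊗ y′) ⊗ u′) ⊕ ((z ⊗ w) ⊗ u ⊕ (z ⊗ w′) ⊗ u′)
      ≡⟨ cong₂ _⊕_ (cong₂ _⊕_ (⊗-assoc x y u) (⊗-assoc x y′ u′))
                   (cong₂ _⊕_ (⊗-assoc z w u) (⊗-assoc z w′ u′)) ⟩
    (x ⊗ (y ⊗ u) ⊕ x ⊗ (y′ ⊗ u′)) ⊕ (z ⊗ (w ⊗ u) ⊕ z ⊗ (w′ ⊗ u′))
      ≡⟨ cong₂ _⊕_ (⊗-distribˡ x (y ⊗ u) (y′ ⊗ u′)) (⊗-distribˡ z (w ⊗ u) (w′ ⊗ u′)) ⟨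
    x ⊗ (y ⊗ u ⊕ y′ ⊗ u′) ⊕ z ⊗ (w ⊗ u ⊕ w′ ⊗ u′) ∎

·-identityˡ : ∀ A → I · A ≡ A
·-identityˡ (mat a b c d) = mat-cong (first a c) (first b d) (second a c) (second b d)
  where
  first : ∀ x y → e1 ⊗ x ⊕ e0 ⊗ y ≡ x
  first x y = by-ring (e1ᴾ ⊗ᴾ Xᴾ ⊕ᴾ e0ᴾ ⊗ᴾ Yᴾ) Xᴾ (env e0 x y e0) refl refl refl refl
  second : ∀ x y → e0 ⊗ x ⊕ e1 ⊗ y ≡ y
  second x y = by-ring (e0ᴾ ⊗ᴾ Xᴾ ⊕ᴾ e1ᴾ ⊗ᴾ Yᴾ) Yᴾ (env e0 x y e0) refl refl refl refl

·-identityʳ : ∀ A → A · I ≡ A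
·-identityʳ (mat a b c d) = mat-cong (first a b) (second a b) (first c d) (second c d)
  where
  first : ∀ x y → x ⊗ e1 ⊕ y ⊗ e0 ≡ x
  first x y = by-ring (Xᴾ ⊗ᴾ e1ᴾ ⊕ᴾ Yᴾ ⊗ᴾ e0ᴾ) Xᴾ (env e0 x y e0) refl refl refl refl
  second : ∀ x y → x ⊗ e0 ⊕ y ⊗ e1 ≡ y
  second x y = by-ring (Xᴾ ⊗ᴾ e0ᴾ ⊕ᴾ Yᴾ ⊗ᴾ e1ᴾ) Yᴾ (env e0 x y e0) refl refl refl refl

module Residues {Z : Set} (𝟘 : Z) (next prev : Z → Z) (_⊞_ : Z → Z → Z)
  (next-prev : ∀ z → next (prev z) ≡ z) (prev-next : ∀ z → prev (next z) ≡ z)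
  (𝟘-⊞ : ∀ z → 𝟘 ⊞ z ≡ z) (next-⊞ : ∀ x y → next x ⊞ y ≡ next (x ⊞ y))
  (prev-⊞ : ∀ x y → prev x ⊞ y ≡ prev (x ⊞ y)) where

  ups downs : ℕ → Z
  ups zero      = 𝟘
  ups (suc n)   = next (ups n)
  downs zero    = prev 𝟘
  downs (suc n) = prev (downs n)

  residue : ℤ → Z
  residue (+ n)    = ups n
  residue -[1+ n ] = downs n

  residue-suc : ∀ a → residue (sucℤ a) ≡ next (residue a)
  residue-suc (+ n)        = refl
  residue-suc -[1+ zero ]  = sym (next-prev 𝟘)
  residue-suc -[1+ suc n ] = sym (next-prev (downs n))

  residue-pred : ∀ a → residue (pred a) ≡ prev (residue a)
  residue-pred (+ zero)  = refl
  residue-pred (+ suc n) = sym (prev-next (ups n))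
  residue-pred -[1+ n ]  = refl

  residue-+ : ∀ a b → residue (a + b) ≡ residue a ⊞ residue b
  residue-+ (+ zero) b = trans (cong residue (ℤ.+-identityˡ b)) (sym (𝟘-⊞ (residue b)))
  residue-+ (+ suc m) b = begin
    residue (+ suc m + b)       ≡⟨ cong residue (ℤ.suc-+ m b) ⟩
    residue (sucℤ (+ m + b))    ≡⟨ residue-suc (+ m + b) ⟩
    next (residue (+ m + b))    ≡⟨ cong next (residue-+ (+ m) b) ⟩
    next (ups m ⊞ residue b)    ≡⟨ next-⊞ (ups m) (residue b) ⟨
    ups (suc m) ⊞ residue b     ∎
    where open ≡-Reasoning
  residue-+ -[1+ zero ] b = begin
    residue (pred b)            ≡⟨ residue-pred b ⟩
    prev (residue b)            ≡⟨ cong prev (𝟘-⊞ (residue b)) ⟨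
    prev (𝟘 ⊞ residue b)        ≡⟨ prev-⊞ 𝟘 (residue b) ⟨
    prev 𝟘 ⊞ residue b          ∎
    where open ≡-Reasoning
  residue-+ -[1+ suc m ] b = begin
    residue (-[1+ suc m ] + b)        ≡⟨ cong residue (ℤ.pred-+ -[1+ m ] b) ⟩
    residue (pred (-[1+ m ] + b))     ≡⟨ residue-pred (-[1+ m ] + b) ⟩
    prev (residue (-[1+ m ] + b))     ≡⟨ cong prev (residue-+ -[1+ m ] b) ⟩
    prev (downs m ⊞ residue b)        ≡⟨ prev-⊞ (downs m) (residue b) ⟨
    downs (suc m) ⊞ residue b         ∎
    where open ≡-Reasoning

data ℤ₃ : Set where
  0₃ 1₃ 2₃ : ℤ₃

suc₃ pred₃ : ℤ₃ → ℤ₃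
suc₃ 0₃ = 1₃
suc₃ 1₃ = 2₃
suc₃ 2₃ = 0₃
pred₃ 0₃ = 2₃
pred₃ 1₃ = 0₃
pred₃ 2₃ = 1₃

infixl 6 _+₃_
_+₃_ : ℤ₃ → ℤ₃ → ℤ₃
0₃ +₃ y = y
1₃ +₃ y = suc₃ y
2₃ +₃ y = suc₃ (suc₃ y)

+₃-identityʳ : ∀ x → x +₃ 0₃ ≡ x
+₃-identityʳ 0₃ = refl
+₃-identityʳ 1₃ = refl
+₃-identityʳ 2₃ = refl

suc₃-pred₃ : ∀ x → suc₃ (pred₃ x) ≡ x
suc₃-pred₃ 0₃ = refl
suc₃-pred₃ 1₃ = refl
suc₃-pred₃ 2₃ = refl

pred₃-suc₃ : ∀ x → pred₃ (suc₃ x) ≡ x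
pred₃-suc₃ 0₃ = refl
pred₃-suc₃ 1₃ = refl
pred₃-suc₃ 2₃ = refl

suc₃-+₃ : ∀ x y → suc₃ x +₃ y ≡ suc₃ (x +₃ y)
suc₃-+₃ 0₃ y  = refl
suc₃-+₃ 1₃ y  = refl
suc₃-+₃ 2₃ 0₃ = refl
suc₃-+₃ 2₃ 1₃ = refl
suc₃-+₃ 2₃ 2₃ = refl

pred₃-+₃ : ∀ x y → pred₃ x +₃ y ≡ pred₃ (x +₃ y)
pred₃-+₃ x y = begin
  pred₃ x +₃ y                   ≡⟨ pred₃-suc₃ (pred₃ x +₃ y) ⟨
  pred₃ (suc₃ (pred₃ x +₃ y))    ≡⟨ cong pred₃ (suc₃-+₃ (pred₃ x) y) ⟨
  pred₃ (suc₃ (pred₃ x) +₃ y)    ≡⟨ cong (λ z → pred₃ (z +₃ y)) (suc₃-pred₃ x) ⟩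
  pred₃ (x +₃ y)                 ∎
  where open ≡-Reasoning

private
  module Mod3 = Residues 0₃ suc₃ pred₃ _+₃_ suc₃-pred₃ pred₃-suc₃ (λ _ → refl) suc₃-+₃ pred₃-+₃
  module Parity = Residues false not not _xor_ not-involutive not-involutive (λ _ → refl)
    (λ x y → sym (not-distribˡ-xor x y)) (λ x y → sym (not-distribˡ-xor x y))

mod3 : ℤ → ℤ₃
mod3 x = Mod3.residue x

mod3-+ : ∀ a b → mod3 (a + b) ≡ mod3 a +₃ mod3 b
mod3-+ = Mod3.residue-+

parity : ℤ → Bool
parity x = Parity.residue x

parity-+ : ∀ a b → parity (a + b) ≡ parity a xor parity b
parity-+ = Parity.residue-+

mod3-multiple : ∀ k → mod3 (k * + 3) ≡ 0₃
mod3-multiple k = begin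
  mod3 (k * + 3)               ≡⟨ cong mod3 (k*3≡k+[k+k] k) ⟩
  mod3 (k + (k + k))           ≡⟨ mod3-+ k (k + k) ⟩
  mod3 k +₃ mod3 (k + k)       ≡⟨ cong (mod3 k +₃_) (mod3-+ k k) ⟩
  mod3 k +₃ (mod3 k +₃ mod3 k) ≡⟨ thrice (mod3 k) ⟩
  0₃                           ∎
  where
  open ≡-Reasoning
  k*3≡k+[k+k] : ∀ k → k * + 3 ≡ k + (k + k)
  k*3≡k+[k+k] = solve-∀
  thrice : ∀ t → t +₃ (t +₃ t) ≡ 0₃
  thrice 0₃ = refl
  thrice 1₃ = refl
  thrice 2₃ = refl

mod3≡0⇒3∣ : ∀ x → mod3 x ≡ 0₃ → + 3 ∣ᵤ x
mod3≡0⇒3∣ x x≡0 = ∣⇒∣ᵤ (subst (+ 3 ∣_) (sym x≡q*3) (∣n⇒∣m*n q ∣-refl))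
  where
  open ≡-Reasoning
  r = x %ℕ 3
  q = x /ℕ 3
  x≡r+q*3 : x ≡ + r + q * + 3
  x≡r+q*3 = a≡a%ℕn+[a/ℕn]*n x 3
  mod3-r : mod3 (+ r) ≡ 0₃
  mod3-r = begin
    mod3 (+ r)                   ≡⟨ +₃-identityʳ (mod3 (+ r)) ⟨
    mod3 (+ r) +₃ 0₃             ≡⟨ cong (mod3 (+ r) +₃_) (mod3-multiple q) ⟨
    mod3 (+ r) +₃ mod3 (q * + 3) ≡⟨ mod3-+ (+ r) (q * + 3) ⟨
    mod3 (+ r + q * + 3)         ≡⟨ cong mod3 x≡r+q*3 ⟨
    mod3 x                       ≡⟨ x≡0 ⟩
    0₃                           ∎
  small-zero : ∀ n → n ℕ.< 3 → mod3 (+ n) ≡ 0₃ → n ≡ 0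
  small-zero 0 _ _ = refl
  small-zero 1 _ ()
  small-zero 2 _ ()
  small-zero (suc (suc (suc _))) (s≤s (s≤s (s≤s ()))) _
  x≡q*3 : x ≡ q * + 3
  x≡q*3 = begin
    x                 ≡⟨ x≡r+q*3 ⟩
    + r + q * + 3     ≡⟨ cong (λ n → + n + q * + 3) (small-zero r (n%ℕd<d x 3) mod3-r) ⟩
    + 0 + q * + 3     ≡⟨ ℤ.+-identityˡ (q * + 3) ⟩
    q * + 3           ∎

record Listed (A : Set) : Set where
  field
    elements : List A
    complete : ∀ a → a ∈ elements

decide-∀ : ∀ {A : Set} {P : A → Set} → Listed A → (∀ a → Dec (P a)) → Dec (∀ a → P a)
decide-∀ L P? = map′ (λ ps a → All.lookup ps (Listed.complete L a)) (λ p → All.tabulate (λ {a} _ → p a))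
                     (All.all? P? (Listed.elements L))

listed-× : ∀ {A B : Set} → Listed A → Listed B → Listed (A × B)
listed-× LA LB = record
  { elements = cartesianProduct (Listed.elements LA) (Listed.elements LB)
  ; complete = λ (a , b) → ∈-cartesianProduct⁺ (Listed.complete LA a) (Listed.complete LB b) }

listed-Bool : Listed Bool
listed-Bool = record { elements = true ∷ false ∷ [] ; complete = complete-Bool }
  where
  complete-Bool : ∀ b → b ∈ true ∷ false ∷ []
  complete-Bool true  = here refl
  complete-Bool false = there (here refl)

listed-ℤ₃ : Listed ℤ₃
listed-ℤ₃ = record { elements = 0₃ ∷ 1₃ ∷ 2₃ ∷ [] ; complete = complete-ℤ₃ }
  where
  complete-ℤ₃ : ∀ x → x ∈ 0₃ ∷ 1₃ ∷ 2₃ ∷ []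
  complete-ℤ₃ 0₃ = here refl
  complete-ℤ₃ 1₃ = there (here refl)
  complete-ℤ₃ 2₃ = there (there (here refl))

listed-Dir : Listed Dir
listed-Dir = record { elements = E ∷ W ∷ NE ∷ SW ∷ NW ∷ SE ∷ [] ; complete = complete-Dir }
  where
  complete-Dir : ∀ d → d ∈ E ∷ W ∷ NE ∷ SW ∷ NW ∷ SE ∷ []
  complete-Dir E  = here refl
  complete-Dir W  = there (here refl)
  complete-Dir NE = there (there (here refl))
  complete-Dir SW = there (there (there (here refl)))
  complete-Dir NW = there (there (there (there (here refl))))
  complete-Dir SE = there (there (there (there (there (here refl)))))

infix 4 _≟ᶜ_ _≟ᴹ_
_≟ᶜ_ : DecidableEquality Cyc
cyc a b c d ≟ᶜ cyc a′ b′ c′ d′ =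
  map′ (λ (p , q , r , s) → cyc-cong p q r s)
       (λ e → cong Cyc.c0 e , cong Cyc.c1 e , cong Cyc.c2 e , cong Cyc.c3 e)
       (a ℤ.≟ a′ ×-dec b ℤ.≟ b′ ×-dec c ℤ.≟ c′ ×-dec d ℤ.≟ d′)

_≟ᴹ_ : DecidableEquality M2
mat a b c d ≟ᴹ mat a′ b′ c′ d′ =
  map′ (λ (p , q , r , s) → mat-cong p q r s)
       (λ e → cong M2.m11 e , cong M2.m12 e , cong M2.m21 e , cong M2.m22 e)
       (a ≟ᶜ a′ ×-dec b ≟ᶜ b′ ×-dec c ≟ᶜ c′ ×-dec d ≟ᶜ d′)

⨁ : ∀ {A : Set} → List A → (A → Bool) → Bool
⨁ []       f = false
⨁ (x ∷ xs) f = f x xor ⨁ xs f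

syntax ⨁ xs (λ x → b) = ⨁[ x ∈ xs ] b

module _ {A : Set} where

  ⨁-cong : ∀ xs {f g : A → Bool} → (∀ {x} → x ∈ xs → f x ≡ g x) → ⨁ xs f ≡ ⨁ xs g
  ⨁-cong []       f≗g = refl
  ⨁-cong (x ∷ xs) f≗g = cong₂ _xor_ (f≗g (here refl)) (⨁-cong xs (f≗g ∘ there))

  ⨁-false : ∀ (xs : List A) → ⨁[ x ∈ xs ] false ≡ false
  ⨁-false []       = refl
  ⨁-false (x ∷ xs) = ⨁-false xs

  ⨁-xor : ∀ xs (f g : A → Bool) → ⨁[ x ∈ xs ] (f x xor g x) ≡ ⨁ xs f xor ⨁ xs g
  ⨁-xor []       f g = refl
  ⨁-xor (x ∷ xs) f g = trans (cong ((f x xor g x) xor_) (⨁-xor xs f g))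
                              (interchange (f x) (g x) (⨁ xs f) (⨁ xs g))

  ⨁-∧ʳ : ∀ xs (f : A → Bool) b → ⨁[ x ∈ xs ] (f x ∧ b) ≡ ⨁ xs f ∧ b
  ⨁-∧ʳ []       f b = refl
  ⨁-∧ʳ (x ∷ xs) f b =
    trans (cong (f x ∧ b xor_) (⨁-∧ʳ xs f b)) (sym (∧-distribʳ-xor b (f x) (⨁ xs f)))

  ⨁-++ : ∀ xs ys (f : A → Bool) → ⨁ (xs ++ ys) f ≡ ⨁ xs f xor ⨁ ys f
  ⨁-++ []       ys f = refl
  ⨁-++ (x ∷ xs) ys f =
    trans (cong (f x xor_) (⨁-++ xs ys f)) (sym (xor-assoc (f x) (⨁ xs f) (⨁ ys f)))

  ⨁-true : ∀ xs (f : A → Bool) → ⨁ xs f ≡ true → ∃ λ x → x ∈ xs × f x ≡ true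
  ⨁-true (x ∷ xs) f sum≡true with f x in fx≡
  ... | true  = x , here refl , fx≡
  ... | false with ⨁-true xs f sum≡true
  ...   | y , y∈xs , fy≡ = y , there y∈xs , fy≡

module _ {A B : Set} where

  ⨁-map : ∀ (g : A → B) xs (f : B → Bool) → ⨁ (map g xs) f ≡ ⨁[ x ∈ xs ] f (g x)
  ⨁-map g []       f = refl
  ⨁-map g (x ∷ xs) f = cong (f (g x) xor_) (⨁-map g xs f)

  ⨁-concatMap : ∀ (g : A → List B) xs (f : B → Bool) →
    ⨁ (concatMap g xs) f ≡ ⨁[ x ∈ xs ] ⨁ (g x) f
  ⨁-concatMap g []       f = refl
  ⨁-concatMap g (x ∷ xs) f =
    trans (⨁-++ (g x) (concatMap g xs) f) (cong (⨁ (g x) f xor_) (⨁-concatMap g xs f))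

module Multiplicity {A : Set} (_≟_ : DecidableEquality A) where
  open DecMembership _≟_ using (_∈?_)

  odd : List A → A → Bool
  odd xs a = ⨁[ x ∈ xs ] does (a ≟ x)

  odd-unique : ∀ {xs} → Unique xs → ∀ a → odd xs a ≡ does (a ∈? xs)
  odd-unique []                    a = refl
  odd-unique {x ∷ xs} (x∉xs ∷ xs!) a = head (a ≟ x) (odd-unique xs! a)
    where
    head : (a≟x : Dec (a ≡ x)) → odd xs a ≡ does (a ∈? xs) →
      does a≟x xor odd xs a ≡ does a≟x ∨ does (a ∈? xs)
    head (yes refl) ih = cong not (trans ih (dec-false (a ∈? xs) (All¬⇒¬Any x∉xs)))
    head (no _)     ih = ih

  ⨁-indicator : ∀ {U} → Unique U → ∀ {x} → x ∈ U → (f : A → Bool) →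
    ⨁[ u ∈ U ] (does (u ≟ x) ∧ f u) ≡ f x
  ⨁-indicator {U} U! {x} x∈U f = begin
    ⨁[ u ∈ U ] (does (u ≟ x) ∧ f u)  ≡⟨ ⨁-cong U (λ {u} _ → swap u) ⟩
    ⨁[ u ∈ U ] (does (x ≟ u) ∧ f x)  ≡⟨ ⨁-∧ʳ U (λ u → does (x ≟ u)) (f x) ⟩
    odd U x ∧ f x                    ≡⟨ cong (_∧ f x) (odd-unique U! x) ⟩
    does (x ∈? U) ∧ f x              ≡⟨ cong (_∧ f x) (dec-true (x ∈? U) x∈U) ⟩
    f x                              ∎
    where
    open ≡-Reasoning
    swap : ∀ u → does (u ≟ x) ∧ f u ≡ does (x ≟ u) ∧ f x
    swap u with u ≟ x
    ... | yes refl = cong (_∧ f u) (sym (dec-true (u ≟ u) refl))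
    ... | no u≢x   = cong (_∧ f x) (sym (dec-false (x ≟ u) (u≢x ∘ sym)))

  ⨁-by-odd : ∀ {U} → Unique U → ∀ xs → (∀ {x} → x ∈ xs → x ∈ U) → (f : A → Bool) →
    ⨁ xs f ≡ ⨁[ u ∈ U ] (odd xs u ∧ f u)
  ⨁-by-odd {U} U! []       _    f = sym (⨁-false U)
  ⨁-by-odd {U} U! (x ∷ xs) xs⊆U f = begin
    f x xor ⨁ xs f
      ≡⟨ cong₂ _xor_ (⨁-indicator U! (xs⊆U (here refl)) f) (sym (⨁-by-odd U! xs (xs⊆U ∘ there) f)) ⟨
    ⨁[ u ∈ U ] (does (u ≟ x) ∧ f u) xor ⨁[ u ∈ U ] (odd xs u ∧ f u)
      ≡⟨ ⨁-xor U (λ u → does (u ≟ x) ∧ f u) (λ u → odd xs u ∧ f u) ⟨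
    ⨁[ u ∈ U ] ((does (u ≟ x) ∧ f u) xor (odd xs u ∧ f u))
      ≡⟨ ⨁-cong U (λ {u} _ → ∧-distribʳ-xor (f u) (does (u ≟ x)) (odd xs u)) ⟨
    ⨁[ u ∈ U ] (odd (x ∷ xs) u ∧ f u) ∎
    where open ≡-Reasoning

  ⨁-odd-cong : ∀ xs ys → (∀ a → a ∈ xs ++ ys → odd xs a ≡ odd ys a) → (f : A → Bool) →
    ⨁ xs f ≡ ⨁ ys f
  ⨁-odd-cong xs ys same-odd f = begin
    ⨁ xs f
      ≡⟨ ⨁-by-odd U! xs (λ x∈ → ∈-deduplicate⁺ _≟_ (∈-++⁺ˡ x∈)) f ⟩
    ⨁[ u ∈ U ] (odd xs u ∧ f u)
      ≡⟨ ⨁-cong U (λ {u} u∈U → cong (_∧ f u) (same-odd u (∈-deduplicate⁻ _≟_ (xs ++ ys) u∈U))) ⟩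
    ⨁[ u ∈ U ] (odd ys u ∧ f u)
      ≡⟨ ⨁-by-odd U! ys (λ y∈ → ∈-deduplicate⁺ _≟_ (∈-++⁺ʳ xs y∈)) f ⟨
    ⨁ ys f ∎
    where
    open ≡-Reasoning
    U = deduplicate _≟_ (xs ++ ys)
    U! = deduplicate-! _≟_ (xs ++ ys)

Klein : Set
Klein = Bool × Bool

0ᴷ : Klein
0ᴷ = (false , false)

infixl 6 _⊕ᴷ_
_⊕ᴷ_ : Klein → Klein → Klein
(a , b) ⊕ᴷ (c , d) = (a xor c , b xor d)

⊕ᴷ-comm : ∀ k k′ → k ⊕ᴷ k′ ≡ k′ ⊕ᴷ k
⊕ᴷ-comm (a , b) (c , d) = cong₂ _,_ (xor-comm a c) (xor-comm b d)

infix 4 _≟ᴷ_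
_≟ᴷ_ : DecidableEquality Klein
_≟ᴷ_ = ≡-dec _≟ᵇ_ _≟ᵇ_

⨁ᴷ : ∀ {A : Set} → List A → (A → Klein) → Klein
⨁ᴷ xs f = (⨁[ x ∈ xs ] proj₁ (f x) , ⨁[ x ∈ xs ] proj₂ (f x))

syntax ⨁ᴷ xs (λ x → k) = ⨁ᴷ[ x ∈ xs ] k

module _ {A : Set} where

  ⨁ᴷ-cong : ∀ xs {f g : A → Klein} → (∀ {x} → x ∈ xs → f x ≡ g x) → ⨁ᴷ xs f ≡ ⨁ᴷ xs g
  ⨁ᴷ-cong xs f≗g = cong₂ _,_ (⨁-cong xs (cong proj₁ ∘ f≗g)) (⨁-cong xs (cong proj₂ ∘ f≗g))

  ⨁ᴷ-zero : ∀ (xs : List A) → ⨁ᴷ[ x ∈ xs ] 0ᴷ ≡ 0ᴷ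
  ⨁ᴷ-zero xs = cong₂ _,_ (⨁-false xs) (⨁-false xs)

  ⨁ᴷ-map : ∀ {B : Set} (g : A → B) xs (f : B → Klein) → ⨁ᴷ (map g xs) f ≡ ⨁ᴷ[ x ∈ xs ] f (g x)
  ⨁ᴷ-map g xs f = cong₂ _,_ (⨁-map g xs (proj₁ ∘ f)) (⨁-map g xs (proj₂ ∘ f))

Q₈ : Set
Q₈ = Bool × Klein

-- (s , a , b) stands for (-1)ˢ iᵃ jᵇ; the sign of a product collects
-- i² = j² = -1 and j i = - i j.
infixl 7 _∙_
_∙_ : Q₈ → Q₈ → Q₈
(s , a , b) ∙ (t , c , d) = (s xor t xor (a ∧ c xor b ∧ d xor b ∧ c) , a xor c , b xor d)

1ᵠ : Q₈
1ᵠ = (false , false , false)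

-ᵠ_ : Q₈ → Q₈
-ᵠ (s , k) = (not s , k)

klein : Q₈ → Klein
klein = proj₂

iᴹ jᴹ : M2
iᴹ = mat (ω^ 2) (ω^ 6) (ω^ 2) (ω^ 8)
jᴹ = mat e0 (ω^ 8) (ω^ 10) e0

unitᴹ : Klein → M2
unitᴹ (false , false) = I
unitᴹ (true  , false) = iᴹ
unitᴹ (false , true ) = jᴹ
unitᴹ (true  , true ) = iᴹ · jᴹ

ρ : Q₈ → M2
ρ (false , k) = unitᴹ k
ρ (true  , k) = -I · unitᴹ k

listed-Q₈ : Listed Q₈
listed-Q₈ = listed-× listed-Bool (listed-× listed-Bool listed-Bool)

ρ-hom : ∀ q q′ → ρ q · ρ q′ ≡ ρ (q ∙ q′)
ρ-hom = from-yes (decide-∀ listed-Q₈ λ q → decide-∀ listed-Q₈ λ q′ → ρ q · ρ q′ ≟ᴹ ρ (q ∙ q′))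

ι : ℤ₃ → Q₈
ι 0₃ = (true  , true  , true )
ι 1₃ = (false , true  , false)
ι 2₃ = (false , false , true )

-- Horizontal edges carry 1ᵠ; a slanted edge carries ι of the height (mod 3) of
-- its endpoint with x ≡ 1 (mod 3), inverted when it is traversed southwards.
edgeLabel : ℤ₃ → Dir → Q₈
edgeLabel y E  = 1ᵠ
edgeLabel y W  = 1ᵠ
edgeLabel y NE = ι y
edgeLabel y SE = -ᵠ ι y
edgeLabel y NW = ι (suc₃ y)
edgeLabel y SW = -ᵠ ι (pred₃ y)

g : M2
g = mat (ω^ 6) e1 (ω^ 6) e0

g^ : ℤ₃ → M2
g^ 0₃ = I
g^ 1₃ = g
g^ 2₃ = g · g

-- The products of two consecutive edge matrices generate a copy of SL(2,3),
-- whose abelianisation ℤ/3 records the change of height mod 3 along a walk;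
-- the powers of the element g of order 3 absorb it.
gauge : ℤ₃ → ℤ₃ → M2
gauge 2₃ y = γ · g^ y
gauge _  y = g^ y

stepˣ stepʸ : Dir → ℤ₃
stepˣ d = mod3 (proj₁ (vec d))
stepʸ d = mod3 (proj₂ (vec d))

0₃? : ∀ a → Dec (a ≡ 0₃)
0₃? 0₃ = yes refl
0₃? 1₃ = no λ ()
0₃? 2₃ = no λ ()

gauge-step : ∀ a b d → a ≢ 0₃ → a +₃ stepˣ d ≢ 0₃ →
  edgeMat d · gauge a b ≡ gauge (a +₃ stepˣ d) (b +₃ stepʸ d) · ρ (edgeLabel b d)
gauge-step = from-yes
  (decide-∀ listed-ℤ₃ λ a → decide-∀ listed-ℤ₃ λ b → decide-∀ listed-Dir λ d →
     ¬? (0₃? a) →-dec ¬? (0₃? (a +₃ stepˣ d)) →-dec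
     edgeMat d · gauge a b ≟ᴹ gauge (a +₃ stepˣ d) (b +₃ stepʸ d) · ρ (edgeLabel b d))

gauge-inverse : ∀ a b → gauge a b · adj (gauge a b) ≡ I
gauge-inverse = from-yes
  (decide-∀ listed-ℤ₃ λ a → decide-∀ listed-ℤ₃ λ b → gauge a b · adj (gauge a b) ≟ᴹ I)

±I : Bool → M2
±I false = I
±I true  = -I

gauge-conjugate : ∀ a b s → (gauge a b · ρ (s , false , false)) · adj (gauge a b) ≡ ±I s
gauge-conjugate = from-yes
  (decide-∀ listed-ℤ₃ λ a → decide-∀ listed-ℤ₃ λ b → decide-∀ listed-Bool λ s →
     (gauge a b · ρ (s , false , false)) · adj (gauge a b) ≟ᴹ ±I s)

conjugate-±I : ∀ M a b s → M · gauge a b ≡ gauge a b · ρ (s , false , false) → M ≡ ±I s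
conjugate-±I M a b s M·G≡G·ρ = begin
  M                                                     ≡⟨ ·-identityʳ M ⟨
  M · I                                                 ≡⟨ cong (M ·_) (gauge-inverse a b) ⟨
  M · (gauge a b · adj (gauge a b))                     ≡⟨ ·-assoc M (gauge a b) (adj (gauge a b)) ⟨
  (M · gauge a b) · adj (gauge a b)                     ≡⟨ cong (_· adj (gauge a b)) M·G≡G·ρ ⟩
  (gauge a b · ρ (s , false , false)) · adj (gauge a b) ≡⟨ gauge-conjugate a b s ⟩
  ±I s                                                  ∎
  where open ≡-Reasoning

Step : Set
Step = Pt × Dir

IsEdge : Step → Set
IsEdge (p , d) = IsVertex p × IsVertex (p +ᵖ vec d)

-- Opaque, so that equations between matrix products involving them are checked
-- without unfolding the products.
opaque
  gaugeAt : Pt → M2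
  gaugeAt (x , y) = gauge (mod3 x) (mod3 y)

  label : Step → Q₈
  label ((x , y) , d) = edgeLabel (mod3 y) d

opaque
  unfolding gaugeAt label

  gaugeAt-def : ∀ x y → gaugeAt (x , y) ≡ gauge (mod3 x) (mod3 y)
  gaugeAt-def x y = refl

  label-def : ∀ x y d → label ((x , y) , d) ≡ edgeLabel (mod3 y) d
  label-def x y d = refl

vertex-mod3≢0 : ∀ p → IsVertex p → mod3 (proj₁ p) ≢ 0₃
vertex-mod3≢0 (x , _) (_ , 3∤x) x≡0 = 3∤x (mod3≡0⇒3∣ x x≡0)

edge-gauge : ∀ p d → IsEdge (p , d) →
  edgeMat d · gaugeAt p ≡ gaugeAt (p +ᵖ vec d) · ρ (label (p , d))
edge-gauge (x , y) d (p-vertex , q-vertex) = begin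
  edgeMat d · gaugeAt (x , y)
    ≡⟨ cong (edgeMat d ·_) (gaugeAt-def x y) ⟩
  edgeMat d · gauge (mod3 x) (mod3 y)
    ≡⟨ gauge-step (mod3 x) (mod3 y) d (vertex-mod3≢0 (x , y) p-vertex) x′≢0 ⟩
  gauge (mod3 x +₃ stepˣ d) (mod3 y +₃ stepʸ d) · ρ (edgeLabel (mod3 y) d)
    ≡⟨ cong₂ (λ a b → gauge a b · ρ (edgeLabel (mod3 y) d))
             (mod3-+ x (proj₁ (vec d))) (mod3-+ y (proj₂ (vec d))) ⟨
  gauge (mod3 (x + proj₁ (vec d))) (mod3 (y + proj₂ (vec d))) · ρ (edgeLabel (mod3 y) d)
    ≡⟨ cong₂ (λ M q → M · ρ q) (gaugeAt-def (x + proj₁ (vec d)) (y + proj₂ (vec d)))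
                               (label-def x y d) ⟨
  gaugeAt ((x , y) +ᵖ vec d) · ρ (label ((x , y) , d)) ∎
  where
  open ≡-Reasoning
  x′≢0 : mod3 x +₃ stepˣ d ≢ 0₃
  x′≢0 = subst (_≢ 0₃) (mod3-+ x (proj₁ (vec d))) (vertex-mod3≢0 ((x , y) +ᵖ vec d) q-vertex)

walkLabel : Pt → List Dir → Q₈
walkLabel p []       = 1ᵠ
walkLabel p (d ∷ ds) = walkLabel (p +ᵖ vec d) ds ∙ label (p , d)

walk-gauge : ∀ p ds → (∀ {e} → e ∈ steps p ds → IsEdge e) →
  walkMat ds · gaugeAt p ≡ gaugeAt (endpoint p ds) · ρ (walkLabel p ds)
walk-gauge p [] _ = trans (·-identityˡ (gaugeAt p)) (sym (·-identityʳ (gaugeAt p)))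
walk-gauge p (d ∷ ds) edges =
  let p′ = p +ᵖ vec d
      ℓ  = label (p , d)
      F′ = gaugeAt (endpoint p′ ds)
      q  = walkLabel p′ ds
  in begin
  (walkMat ds · edgeMat d) · gaugeAt p  ≡⟨ ·-assoc (walkMat ds) (edgeMat d) (gaugeAt p) ⟩
  walkMat ds · (edgeMat d · gaugeAt p)  ≡⟨ cong (walkMat ds ·_) (edge-gauge p d (edges (here refl))) ⟩
  walkMat ds · (gaugeAt p′ · ρ ℓ)       ≡⟨ ·-assoc (walkMat ds) (gaugeAt p′) (ρ ℓ) ⟨
  (walkMat ds · gaugeAt p′) · ρ ℓ       ≡⟨ cong (_· ρ ℓ) (walk-gauge p′ ds (edges ∘ there)) ⟩
  (F′ · ρ q) · ρ ℓ                      ≡⟨ ·-assoc F′ (ρ q) (ρ ℓ) ⟩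
  F′ · (ρ q · ρ ℓ)                      ≡⟨ cong (F′ ·_) (ρ-hom q ℓ) ⟩
  F′ · ρ (q ∙ ℓ)                        ∎
  where open ≡-Reasoning

klein-walkLabel : ∀ p ds → klein (walkLabel p ds) ≡ ⨁ᴷ[ e ∈ steps p ds ] klein (label e)
klein-walkLabel p []       = refl
klein-walkLabel p (d ∷ ds) =
  trans (cong (_⊕ᴷ klein (label (p , d))) (klein-walkLabel (p +ᵖ vec d) ds))
        (⊕ᴷ-comm (⨁ᴷ[ e ∈ steps (p +ᵖ vec d) ds ] klein (label e)) (klein (label (p , d))))

infix 4 _≟ᵖ_
_≟ᵖ_ : DecidableEquality Pt
_≟ᵖ_ = _≟ₕ_

-ᵖ_ : Pt → Pt
-ᵖ (a , b) = (- a , - b)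

+ᵖ-assoc : ∀ p q r → p +ᵖ q +ᵖ r ≡ p +ᵖ (q +ᵖ r)
+ᵖ-assoc (a , b) (c , d) (e , f) = cong₂ _,_ (ℤ.+-assoc a c e) (ℤ.+-assoc b d f)

origin : Pt
origin = (0ℤ , 0ℤ)

+ᵖ-identityʳ : ∀ p → p +ᵖ origin ≡ p
+ᵖ-identityʳ (a , b) = cong₂ _,_ (ℤ.+-identityʳ a) (ℤ.+-identityʳ b)

+ᵖ-cancelʳ : ∀ p q → p +ᵖ q +ᵖ (-ᵖ q) ≡ p
+ᵖ-cancelʳ (a , b) (c , d) = cong₂ _,_ (cancel a c) (cancel b d)
  where
  cancel : ∀ x y → x + y + - y ≡ x
  cancel = solve-∀

+ᵖ-cancelʳ′ : ∀ p q → p +ᵖ (-ᵖ q) +ᵖ q ≡ p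
+ᵖ-cancelʳ′ (a , b) (c , d) = cong₂ _,_ (cancel a c) (cancel b d)
  where
  cancel : ∀ x y → x + - y + y ≡ x
  cancel = solve-∀

+-cancelˡ : ∀ i {j k} → i + j ≡ i + k → j ≡ k
+-cancelˡ i {j} {k} eq = trans (sym (unshift i j)) (trans (cong (λ n → - i + n) eq) (unshift i k))
  where
  unshift : ∀ i j → - i + (i + j) ≡ j
  unshift = solve-∀

+ᵖ-injective : ∀ p {a b} → p +ᵖ a ≡ p +ᵖ b → a ≡ b
+ᵖ-injective (x , y) eq = cong₂ _,_ (+-cancelˡ x (cong proj₁ eq)) (+-cancelˡ y (cong proj₂ eq))

≟ᵖ-translate : ∀ p c o → does (p ≟ᵖ c +ᵖ o) ≡ does (c ≟ᵖ p +ᵖ (-ᵖ o))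
≟ᵖ-translate p c o = does-⇔
  (mk⇔ (λ p≡c+o → trans (sym (+ᵖ-cancelʳ c o)) (cong (_+ᵖ (-ᵖ o)) (sym p≡c+o)))
       (λ c≡p-o → trans (sym (+ᵖ-cancelʳ′ p o)) (cong (_+ᵖ o) (sym c≡p-o))))
  (p ≟ᵖ c +ᵖ o) (c ≟ᵖ p +ᵖ (-ᵖ o))

center-+ : ∀ h u → center (h +ᵖ u) ≡ center h +ᵖ center u
center-+ (q , r) (q′ , r′) = cong₂ _,_ (ℤ.*-distribˡ-+ (+ 3) q q′) (regroup q r q′ r′)
  where
  regroup : ∀ q r q′ r′ → q + q′ + + 2 * (r + r′) ≡ q + + 2 * r + (q′ + + 2 * r′)
  regroup = solve-∀

center-injective : ∀ {h h′} → center h ≡ center h′ → h ≡ h′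
center-injective {q , r} {q′ , r′} eq = cong₂ _,_ q≡q′ (ℤ.*-cancelˡ-≡ (+ 2) r r′ 2r≡2r′)
  where
  q≡q′ : q ≡ q′
  q≡q′ = ℤ.*-cancelˡ-≡ (+ 3) q q′ (cong proj₁ eq)
  2r≡2r′ : + 2 * r ≡ + 2 * r′
  2r≡2r′ = +-cancelˡ q (trans (cong proj₂ eq) (cong (_+ + 2 * r′) (sym q≡q′)))

opposite : Dir → Dir
opposite E  = W
opposite W  = E
opposite NE = SW
opposite SW = NE
opposite NW = SE
opposite SE = NW

opposite-involutive : ∀ d → opposite (opposite d) ≡ d
opposite-involutive E  = refl
opposite-involutive W  = refl
opposite-involutive NE = refl
opposite-involutive SW = refl
opposite-involutive NW = refl
opposite-involutive SE = refl

vec-opposite : ∀ d → vec (opposite d) ≡ -ᵖ vec d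
vec-opposite E  = refl
vec-opposite W  = refl
vec-opposite NE = refl
vec-opposite SW = refl
vec-opposite NW = refl
vec-opposite SE = refl

dirIndex : Dir → ℕ
dirIndex E  = 0
dirIndex W  = 1
dirIndex NE = 2
dirIndex SW = 3
dirIndex NW = 4
dirIndex SE = 5

dirIndex-injective : ∀ {d d′} → dirIndex d ≡ dirIndex d′ → d ≡ d′
dirIndex-injective {d} {d′} eq = trans (sym (from-index d)) (trans (cong from eq) (from-index d′))
  where
  from : ℕ → Dir
  from 0 = E
  from 1 = W
  from 2 = NE
  from 3 = SW
  from 4 = NW
  from _ = SE
  from-index : ∀ d → from (dirIndex d) ≡ d
  from-index E  = refl
  from-index W  = refl
  from-index NE = refl
  from-index SW = refl
  from-index NW = refl
  from-index SE = refl

infix 4 _≟ᵈ_ _≟ˢ_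
_≟ᵈ_ : DecidableEquality Dir
d ≟ᵈ d′ = map′ dirIndex-injective (cong dirIndex) (dirIndex d ℕ.≟ dirIndex d′)

-- Directions are compared first, so that sums over the sides of a hexagon
-- reduce by computation once the direction is known.
_≟ˢ_ : DecidableEquality Step
(p , d) ≟ˢ (q , d′) =
  map′ (λ (d≡d′ , p≡q) → cong₂ _,_ p≡q d≡d′) (λ e → cong proj₂ e , cong proj₁ e) (d ≟ᵈ d′ ×-dec p ≟ᵖ q)

module Mˢ = Multiplicity _≟ˢ_

rev : Step → Step
rev (p , d) = (p +ᵖ vec d , opposite d)

rev-point : ∀ p d → p +ᵖ vec d +ᵖ vec (opposite d) ≡ p
rev-point p d = trans (cong (p +ᵖ vec d +ᵖ_) (vec-opposite d)) (+ᵖ-cancelʳ p (vec d))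

rev-involutive : ∀ e → rev (rev e) ≡ e
rev-involutive (p , d) = cong₂ _,_ (rev-point p d) (opposite-involutive d)

rev-edge : ∀ e → IsEdge e → IsEdge (rev e)
rev-edge (p , d) (p-vertex , q-vertex) = q-vertex , subst IsVertex (sym (rev-point p d)) p-vertex

leftOf rightOf : Step → Pt
leftOf  (p , d) = p +ᵖ leftOff d
rightOf (p , d) = p +ᵖ rightOff d

leftOf-rev : ∀ e → leftOf (rev e) ≡ rightOf e
leftOf-rev (p , d) = trans (+ᵖ-assoc p (vec d) (leftOff (opposite d))) (cong (p +ᵖ_) (across d))
  where
  across : ∀ d → vec d +ᵖ leftOff (opposite d) ≡ rightOff d
  across E  = refl
  across W  = refl
  across NE = refl
  across SW = refl
  across NW = refl
  across SE = refl

rightOf-rev : ∀ e → rightOf (rev e) ≡ leftOf e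
rightOf-rev e = trans (sym (leftOf-rev (rev e))) (cong leftOf (rev-involutive e))

true≢false : true ≢ false
true≢false ()

canonical : Dir → Bool
canonical W  = true
canonical NE = true
canonical NW = true
canonical _  = false

canonical-opposite : ∀ d → canonical (opposite d) ≡ not (canonical d)
canonical-opposite E  = refl
canonical-opposite W  = refl
canonical-opposite NE = refl
canonical-opposite SW = refl
canonical-opposite NW = refl
canonical-opposite SE = refl

canon : Step → Step
canon e = if canonical (proj₂ e) then e else rev e

canon-canonical : ∀ e → canonical (proj₂ (canon e)) ≡ true
canon-canonical (p , d) with canonical d in d-canonical
... | true  = d-canonical
... | false = trans (canonical-opposite d) (cong not d-canonical)

canon-edge : ∀ e → IsEdge e → IsEdge (canon e)
canon-edge (p , d) e-edge with canonical d
... | true  = e-edge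
... | false = rev-edge (p , d) e-edge

≟-canon : ∀ a e → canonical (proj₂ a) ≡ true →
  does (a ≟ˢ canon e) ≡ does (a ≟ˢ e) xor does (rev a ≟ˢ e)
≟-canon a@(p , d) e@(q , d′) a-canonical = by-orientation (canonical d′) refl
  where
  by-orientation : ∀ b → canonical d′ ≡ b →
    does (a ≟ˢ (if b then e else rev e)) ≡ does (a ≟ˢ e) xor does (rev a ≟ˢ e)
  by-orientation true e-canonical =
    sym (trans (cong (does (a ≟ˢ e) xor_) (dec-false (rev a ≟ˢ e) rev-a≢e)) (xor-identityʳ _))
    where
    rev-a≢e : rev a ≢ e
    rev-a≢e ra≡e = true≢false (begin
      true                      ≡⟨ e-canonical ⟨
      canonical d′              ≡⟨ cong (canonical ∘ proj₂) ra≡e ⟨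
      canonical (opposite d)    ≡⟨ canonical-opposite d ⟩
      not (canonical d)         ≡⟨ cong not a-canonical ⟩
      false                     ∎)
      where open ≡-Reasoning
  by-orientation false e-noncanonical =
    trans (does-⇔ (mk⇔ (λ a≡re → trans (cong rev a≡re) (rev-involutive e))
                       (λ ra≡e → trans (sym (rev-involutive a)) (cong rev ra≡e)))
                  (a ≟ˢ rev e) (rev a ≟ˢ e))
          (cong (_xor does (rev a ≟ˢ e)) (sym (dec-false (a ≟ˢ e) a≢e)))
    where
    a≢e : a ≢ e
    a≢e a≡e = true≢false (trans (sym a-canonical) (trans (cong (canonical ∘ proj₂) a≡e) e-noncanonical))


move : Pt → Step → Step
move c (o , d) = (c +ᵖ o , d)

hexagonSides : List Step
hexagonSides = ((1ℤ , -1ℤ) , NE) ∷ ((+ 2 , 0ℤ) , NW) ∷ ((1ℤ , 1ℤ) , W)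
             ∷ ((-[1+ 1 ] , 0ℤ) , NE) ∷ ((-1ℤ , -1ℤ) , NW) ∷ ((1ℤ , -1ℤ) , W) ∷ []

sides : Pt → List Step
sides c = map (move c) hexagonSides

sides-canonical : ∀ c {σ} → σ ∈ sides c → canonical (proj₂ σ) ≡ true
sides-canonical c (here refl)                                         = refl
sides-canonical c (there (here refl))                                 = refl
sides-canonical c (there (there (here refl)))                         = refl
sides-canonical c (there (there (there (here refl))))                 = refl
sides-canonical c (there (there (there (there (here refl)))))         = refl
sides-canonical c (there (there (there (there (there (here refl)))))) = refl

corner : ∀ h a b {2∣a+b : True (+ 2 ∣? a + b)} {3∤a : False (+ 3 ∣? a)} →
  IsVertex (center h +ᵖ (a , b))
corner (q , r) a b {2∣a+b} {3∤a} = ∣⇒∣ᵤ 2∣x+y , 3∤x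
  where
  regroup : ∀ q r a b → + 3 * q + a + (q + + 2 * r + b) ≡ (+ 2 * q + r) * + 2 + (a + b)
  regroup = solve-∀
  2∣x+y : + 2 ∣ + 3 * q + a + (q + + 2 * r + b)
  2∣x+y = subst (+ 2 ∣_) (sym (regroup q r a b))
                (∣m∣n⇒∣m+n (∣n⇒∣m*n (+ 2 * q + r) ∣-refl) (toWitness 2∣a+b))
  3∤x : ¬ (+ 3 ∣ᵤ + 3 * q + a)
  3∤x 3∣x = toWitnessFalse 3∤a (∣m+n∣m⇒∣n (∣ᵤ⇒∣ 3∣x) (∣m⇒∣m*n q ∣-refl))

sides-edges : ∀ h {σ} → σ ∈ sides (center h) → IsEdge σ
sides-edges h (here refl) =
  corner h 1ℤ -1ℤ , subst IsVertex (sym (+ᵖ-assoc (center h) _ _)) (corner h (+ 2) 0ℤ)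
sides-edges h (there (here refl)) =
  corner h (+ 2) 0ℤ , subst IsVertex (sym (+ᵖ-assoc (center h) _ _)) (corner h 1ℤ 1ℤ)
sides-edges h (there (there (here refl))) =
  corner h 1ℤ 1ℤ , subst IsVertex (sym (+ᵖ-assoc (center h) _ _)) (corner h -1ℤ 1ℤ)
sides-edges h (there (there (there (here refl)))) =
  corner h -[1+ 1 ] 0ℤ , subst IsVertex (sym (+ᵖ-assoc (center h) _ _)) (corner h -1ℤ 1ℤ)
sides-edges h (there (there (there (there (here refl))))) =
  corner h -1ℤ -1ℤ , subst IsVertex (sym (+ᵖ-assoc (center h) _ _)) (corner h -[1+ 1 ] 0ℤ)
sides-edges h (there (there (there (there (there (here refl)))))) =
  corner h 1ℤ -1ℤ , subst IsVertex (sym (+ᵖ-assoc (center h) _ _)) (corner h -1ℤ -1ℤ)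

odd-sides : ∀ c a → canonical (proj₂ a) ≡ true →
  Mˢ.odd (sides c) a ≡ does (c ≟ᵖ leftOf a) xor does (c ≟ᵖ rightOf a)
odd-sides c (p , W) _ =
  cong₂ _xor_ (≟ᵖ-translate p c (1ℤ , 1ℤ)) (trans (xor-identityʳ _) (≟ᵖ-translate p c (1ℤ , -1ℤ)))
odd-sides c (p , NE) _ =
  cong₂ _xor_ (≟ᵖ-translate p c (1ℤ , -1ℤ)) (trans (xor-identityʳ _) (≟ᵖ-translate p c (-[1+ 1 ] , 0ℤ)))
odd-sides c (p , NW) _ =
  cong₂ _xor_ (≟ᵖ-translate p c (+ 2 , 0ℤ)) (trans (xor-identityʳ _) (≟ᵖ-translate p c (-1ℤ , -1ℤ)))

κ : Step → Klein
κ ((x , y) , d) = klein (edgeLabel (mod3 y) d)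

klein-label : ∀ e → klein (label e) ≡ κ e
klein-label ((x , y) , d) = cong klein (label-def x y d)

κ-rev : ∀ e → κ (rev e) ≡ κ e
κ-rev ((x , y) , d) =
  trans (cong (λ z → klein (edgeLabel z (opposite d))) (mod3-+ y (proj₂ (vec d))))
        (label-opposite (mod3 y) d)
  where
  label-opposite : ∀ y d → klein (edgeLabel (y +₃ stepʸ d) (opposite d)) ≡ klein (edgeLabel y d)
  label-opposite = from-yes (decide-∀ listed-ℤ₃ λ y → decide-∀ listed-Dir λ d →
    klein (edgeLabel (y +₃ stepʸ d) (opposite d)) ≟ᴷ klein (edgeLabel y d))

κ-canon : ∀ e → κ (canon e) ≡ κ e
κ-canon e = by-orientation (canonical (proj₂ e))
  where
  by-orientation : ∀ b → κ (if b then e else rev e) ≡ κ e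
  by-orientation true  = refl
  by-orientation false = κ-rev e

hexagon-κ : ∀ c → ⨁ᴷ[ σ ∈ sides c ] κ σ ≡ klein (ι (mod3 (proj₂ c)))
hexagon-κ c@(x , y) = begin
  ⨁ᴷ[ σ ∈ sides c ] κ σ
    ≡⟨ ⨁ᴷ-map (move c) hexagonSides κ ⟩
  ⨁ᴷ[ σ ∈ hexagonSides ] κ (move c σ)
    ≡⟨ ⨁ᴷ-cong hexagonSides (λ {σ} _ →
         cong (λ z → klein (edgeLabel z (proj₂ σ))) (mod3-+ y (proj₂ (proj₁ σ)))) ⟩
  ⨁ᴷ[ σ ∈ hexagonSides ] κ-at (mod3 y) σ
    ≡⟨ at-height (mod3 y) ⟩
  klein (ι (mod3 y)) ∎
  where
  open ≡-Reasoning
  κ-at : ℤ₃ → Step → Klein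
  κ-at k ((_ , b) , d) = klein (edgeLabel (k +₃ mod3 b) d)
  at-height : ∀ k → ⨁ᴷ[ σ ∈ hexagonSides ] κ-at k σ ≡ klein (ι k)
  at-height = from-yes (decide-∀ listed-ℤ₃ λ k → ⨁ᴷ[ σ ∈ hexagonSides ] κ-at k σ ≟ᴷ klein (ι k))

colour : Hex → ℤ₃
colour h = mod3 (proj₂ (center h))

colour-+ : ∀ h u → colour (h +ᵖ u) ≡ colour h +₃ colour u
colour-+ h u =
  trans (cong (mod3 ∘ proj₂) (center-+ h u)) (mod3-+ (proj₂ (center h)) (proj₂ (center u)))

anchor : Tile → Hex
anchor (bone p _)    = p
anchor (stone p _ _) = p
anchor (snake p _ _) = p

offsets : Tile → List Hex
offsets (bone _ i)    = origin ∷ hdir i ∷ hdir i +ᵖ hdir i ∷ []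
offsets (stone _ i b) = origin ∷ hdir i ∷ hdir (turn b i) ∷ []
offsets (snake _ i b) =
  origin ∷ hdir i ∷ hdir i +ᵖ hdir (turn b i) ∷ hdir i +ᵖ hdir i +ᵖ hdir (turn b i) ∷ []

cells-offsets : ∀ t → cells t ≡ map (anchor t +ᵖ_) (offsets t)
cells-offsets (bone p i) = cong₂ _∷_ (sym (+ᵖ-identityʳ p))
  (cong ((p +ᵖ hdir i) ∷_) (cong (_∷ []) (+ᵖ-assoc p (hdir i) (hdir i))))
cells-offsets (stone p i b) =
  cong (_∷ (p +ᵖ hdir i ∷ p +ᵖ hdir (turn b i) ∷ [])) (sym (+ᵖ-identityʳ p))
cells-offsets (snake p i b) =
  cong₂ _∷_ (sym (+ᵖ-identityʳ p)) (cong ((p +ᵖ u) ∷_) (cong₂ _∷_ (+ᵖ-assoc p u w)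
    (cong (_∷ []) (trans (cong (_+ᵖ w) (+ᵖ-assoc p u u)) (+ᵖ-assoc p (u +ᵖ u) w)))))
  where
  u = hdir i
  w = hdir (turn b i)

offsets-κ? : ∀ t c → Dec (⨁ᴷ[ o ∈ offsets t ] klein (ι (c +₃ colour o)) ≡ 0ᴷ)
offsets-κ? t c = ⨁ᴷ[ o ∈ offsets t ] klein (ι (c +₃ colour o)) ≟ᴷ 0ᴷ

-- A bone or a stone covers the three colours once each and a snake covers two
-- colours twice each; the three values klein (ι c) add up to zero.
offsets-κ : ∀ c t → ⨁ᴷ[ o ∈ offsets t ] klein (ι (c +₃ colour o)) ≡ 0ᴷ
offsets-κ c (bone _ i) =
  from-yes (decide-∀ listed-ℤ₃ λ c → all? λ i → offsets-κ? (bone origin i) c) c i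
offsets-κ c (stone _ i b) =
  from-yes (decide-∀ listed-ℤ₃ λ c → all? λ i → decide-∀ listed-Bool λ b →
    offsets-κ? (stone origin i b) c) c i b
offsets-κ c (snake _ i b) =
  from-yes (decide-∀ listed-ℤ₃ λ c → all? λ i → decide-∀ listed-Bool λ b →
    offsets-κ? (snake origin i b) c) c i b

tile-κ : ∀ t → ⨁ᴷ[ h ∈ cells t ] klein (ι (colour h)) ≡ 0ᴷ
tile-κ t = begin
  ⨁ᴷ[ h ∈ cells t ] klein (ι (colour h))
    ≡⟨ cong (λ hs → ⨁ᴷ[ h ∈ hs ] klein (ι (colour h))) (cells-offsets t) ⟩
  ⨁ᴷ[ h ∈ map (anchor t +ᵖ_) (offsets t) ] klein (ι (colour h))
    ≡⟨ ⨁ᴷ-map (anchor t +ᵖ_) (offsets t) (klein ∘ ι ∘ colour) ⟩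
  ⨁ᴷ[ o ∈ offsets t ] klein (ι (colour (anchor t +ᵖ o)))
    ≡⟨ ⨁ᴷ-cong (offsets t) (λ {o} _ → cong (klein ∘ ι) (colour-+ (anchor t) o)) ⟩
  ⨁ᴷ[ o ∈ offsets t ] klein (ι (colour (anchor t) +₃ colour o))
    ≡⟨ offsets-κ (colour (anchor t)) t ⟩
  0ᴷ ∎
  where open ≡-Reasoning

cells-unique : ∀ t → Unique (cells t)
cells-unique t =
  subst Unique (sym (cells-offsets t)) (Unique.map⁺ (+ᵖ-injective (anchor t)) (offsets-unique t))
  where
  offsets-unique : ∀ t → Unique (offsets t)
  offsets-unique (bone _ i)    = from-yes (all? λ i → unique? (offsets (bone origin i))) i
  offsets-unique (stone _ i b) =
    from-yes (all? λ i → decide-∀ listed-Bool λ b → unique? (offsets (stone origin i b))) i b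
  offsets-unique (snake _ i b) =
    from-yes (all? λ i → decide-∀ listed-Bool λ b → unique? (offsets (snake origin i b))) i b

open DecMembership _≟ₕ_ using () renaming (_∈?_ to _∈ₕ?_)
module Mₕ = Multiplicity _≟ₕ_

parity-coverage : ∀ T h → parity (coverage T h) ≡ ⨁[ st ∈ T ] does (h ∈ₕ? cells (proj₂ st))
parity-coverage []            h = refl
parity-coverage ((s , t) ∷ T) h =
  trans (parity-+ (if does (h ∈ₕ? cells t) then weight s else 0ℤ) (coverage T h))
        (cong₂ _xor_ (parity-weight (does (h ∈ₕ? cells t)) s) (parity-coverage T h))
  where
  parity-weight : ∀ b s → parity (if b then weight s else 0ℤ) ≡ b
  parity-weight true  Sign.+ = refl
  parity-weight true  Sign.- = refl
  parity-weight false _      = refl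

cellParity : List (Sign × Tile) → Pt → Bool
cellParity T c = ⨁[ st ∈ T ] ⨁[ h ∈ cells (proj₂ st) ] does (center h ≟ᵖ c)

cellParity-center : ∀ T h → cellParity T (center h) ≡ parity (coverage T h)
cellParity-center T h = begin
  ⨁[ st ∈ T ] ⨁[ h′ ∈ cells (proj₂ st) ] does (center h′ ≟ᵖ center h)
    ≡⟨ ⨁-cong T (λ {st} _ → ⨁-cong (cells (proj₂ st)) (λ {h′} _ →
         does-⇔ (mk⇔ (sym ∘ center-injective) (cong center ∘ sym)) (center h′ ≟ᵖ center h) (h ≟ₕ h′))) ⟩
  ⨁[ st ∈ T ] Mₕ.odd (cells (proj₂ st)) h
    ≡⟨ ⨁-cong T (λ {st} _ → Mₕ.odd-unique (cells-unique (proj₂ st)) h) ⟩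
  ⨁[ st ∈ T ] does (h ∈ₕ? cells (proj₂ st))
    ≡⟨ parity-coverage T h ⟨
  parity (coverage T h) ∎
  where open ≡-Reasoning

IsSignedTiling : List Hex → List (Sign × Tile) → Set
IsSignedTiling R T = ∀ h → (h ∈ R → coverage T h ≡ 1ℤ) × (h ∉ R → coverage T h ≡ 0ℤ)

CenterIn? : ∀ R c → Dec (CenterIn R c)
CenterIn? R c = any? (λ h → center h ≟ᵖ c) R

cellParity-inside : ∀ {R T} → IsSignedTiling R T → ∀ c → cellParity T c ≡ does (CenterIn? R c)
cellParity-inside {R} {T} tiling c with CenterIn? R c
... | yes c∈R with find c∈R
...   | h , h∈R , refl = trans (cellParity-center T h) (cong parity (proj₁ (tiling h) h∈R))
cellParity-inside {R} {T} tiling c | no c∉R = ¬-not odd-cover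
  where
  odd-cover : cellParity T c ≢ true
  odd-cover parity≡true with ⨁-true T (λ st → ⨁[ h ∈ cells (proj₂ st) ] does (center h ≟ᵖ c)) parity≡true
  ... | (s , t) , _ , cells≡true with ⨁-true (cells t) (λ h → does (center h ≟ᵖ c)) cells≡true
  ...   | h , _ , centre≡true with center h ≟ᵖ c
  ...     | yes h-at-c = true≢false (begin
    true                           ≡⟨ parity≡true ⟨
    cellParity T c              ≡⟨ cong (cellParity T) h-at-c ⟨
    cellParity T (center h)     ≡⟨ cellParity-center T h ⟩
    parity (coverage T h)          ≡⟨ cong parity (proj₂ (tiling h) h∉R) ⟩
    false                          ∎)
    where
    open ≡-Reasoning
    h∉R : h ∉ R
    h∉R h∈R = c∉R (Any.map (λ h≡h′ → trans (cong center (sym h≡h′)) h-at-c) h∈R)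


steps-starts : ∀ p ds → map proj₁ (steps p ds) ≡ starts p ds
steps-starts p []       = refl
steps-starts p (d ∷ ds) = cong (p ∷_) (steps-starts (p +ᵖ vec d) ds)

xor-exclusive : ∀ x y → (x ∧ not y) xor (y ∧ not x) ≡ x xor y
xor-exclusive true  true  = refl
xor-exclusive true  false = refl
xor-exclusive false true  = refl
xor-exclusive false false = refl

module Boundary {R v ds} (∂R : CCWBoundary R v ds) {T} (tiling : IsSignedTiling R T) where
  open CCWBoundary ∂R
  open DecMembership _≟ˢ_ using (_∈?_)

  D : List Step
  D = steps v ds

  D-unique : Unique D
  D-unique = Unique.map⁻ (subst Unique (sym (steps-starts v ds)) simple)

  D-edge : ∀ {e} → e ∈ D → IsEdge e
  D-edge e∈D = let (p-vertex , q-vertex , _ , _) = onBdry e∈D in p-vertex , q-vertex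

  inside : Pt → Bool
  inside c = does (CenterIn? R c)

  odd-boundary : ∀ a → IsEdge a → Mˢ.odd D a ≡ inside (leftOf a) ∧ not (inside (rightOf a))
  odd-boundary a (p-vertex , q-vertex) = trans (Mˢ.odd-unique D-unique a)
    (does-⇔ (mk⇔ (λ a∈D → let (_ , _ , in-left , out-right) = onBdry a∈D in in-left , out-right)
                 (λ (in-left , out-right) → complete a (p-vertex , q-vertex , in-left , out-right)))
            (a ∈? D) (CenterIn? R (leftOf a) ×-dec ¬? (CenterIn? R (rightOf a))))

  odd-boundary-rev : ∀ a → IsEdge a → Mˢ.odd D (rev a) ≡ inside (rightOf a) ∧ not (inside (leftOf a))
  odd-boundary-rev a a-edge = trans (odd-boundary (rev a) (rev-edge a a-edge))
    (cong₂ (λ l r → inside l ∧ not (inside r)) (leftOf-rev a) (rightOf-rev a))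

  odd-canon-boundary : ∀ a → canonical (proj₂ a) ≡ true → IsEdge a →
    Mˢ.odd (map canon D) a ≡ inside (leftOf a) xor inside (rightOf a)
  odd-canon-boundary a a-canonical a-edge = begin
    Mˢ.odd (map canon D) a
      ≡⟨ ⨁-map canon D (λ e → does (a ≟ˢ e)) ⟩
    ⨁[ e ∈ D ] does (a ≟ˢ canon e)
      ≡⟨ ⨁-cong D (λ {e} _ → ≟-canon a e a-canonical) ⟩
    ⨁[ e ∈ D ] (does (a ≟ˢ e) xor does (rev a ≟ˢ e))
      ≡⟨ ⨁-xor D (λ e → does (a ≟ˢ e)) (λ e → does (rev a ≟ˢ e)) ⟩
    Mˢ.odd D a xor Mˢ.odd D (rev a)
      ≡⟨ cong₂ _xor_ (odd-boundary a a-edge) (odd-boundary-rev a a-edge) ⟩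
    (inside (leftOf a) ∧ not (inside (rightOf a))) xor (inside (rightOf a) ∧ not (inside (leftOf a)))
      ≡⟨ xor-exclusive (inside (leftOf a)) (inside (rightOf a)) ⟩
    inside (leftOf a) xor inside (rightOf a) ∎
    where open ≡-Reasoning

  cellSides : Sign × Tile → List Step
  cellSides (_ , t) = concatMap (sides ∘ center) (cells t)

  tileSides : List Step
  tileSides = concatMap cellSides T

  ⨁-tileSides : ∀ f → ⨁ tileSides f ≡ ⨁[ st ∈ T ] ⨁[ h ∈ cells (proj₂ st) ] ⨁ (sides (center h)) f
  ⨁-tileSides f = trans (⨁-concatMap cellSides T f)
    (⨁-cong T (λ {st} _ → ⨁-concatMap (sides ∘ center) (cells (proj₂ st)) f))

  inside-parity : ∀ c → cellParity T c ≡ inside c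
  inside-parity = cellParity-inside {R} {T} tiling

  odd-tileSides : ∀ a → canonical (proj₂ a) ≡ true →
    Mˢ.odd tileSides a ≡ inside (leftOf a) xor inside (rightOf a)
  odd-tileSides a a-canonical = begin
    Mˢ.odd tileSides a
      ≡⟨ ⨁-tileSides (λ σ → does (a ≟ˢ σ)) ⟩
    ⨁[ st ∈ T ] ⨁[ h ∈ cells (proj₂ st) ] Mˢ.odd (sides (center h)) a
      ≡⟨ ⨁-cong T (λ {st} _ → ⨁-cong (cells (proj₂ st)) (λ {h} _ → odd-sides (center h) a a-canonical)) ⟩
    ⨁[ st ∈ T ] ⨁[ h ∈ cells (proj₂ st) ] (does (center h ≟ᵖ leftOf a) xor does (center h ≟ᵖ rightOf a))
      ≡⟨ ⨁-cong T (λ {st} _ → ⨁-xor (cells (proj₂ st)) (λ h → does (center h ≟ᵖ leftOf a))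
                                                           (λ h → does (center h ≟ᵖ rightOf a))) ⟩
    ⨁[ st ∈ T ] (⨁[ h ∈ cells (proj₂ st) ] does (center h ≟ᵖ leftOf a) xor
                 ⨁[ h ∈ cells (proj₂ st) ] does (center h ≟ᵖ rightOf a))
      ≡⟨ ⨁-xor T _ _ ⟩
    cellParity T (leftOf a) xor cellParity T (rightOf a)
      ≡⟨ cong₂ _xor_ (inside-parity (leftOf a)) (inside-parity (rightOf a)) ⟩
    inside (leftOf a) xor inside (rightOf a) ∎
    where open ≡-Reasoning

  canonical-edge : ∀ {a} → a ∈ map canon D ++ tileSides → canonical (proj₂ a) ≡ true × IsEdge a
  canonical-edge {a} a∈ = [ from-boundary , from-tiles ]′ (∈-++⁻ (map canon D) a∈)
    where
    from-boundary : a ∈ map canon D → canonical (proj₂ a) ≡ true × IsEdge a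
    from-boundary a∈canonD = let (e , e∈D , a≡canon-e) = ∈-map⁻ canon a∈canonD in
      subst (λ a → canonical (proj₂ a) ≡ true × IsEdge a) (sym a≡canon-e)
            (canon-canonical e , canon-edge e (D-edge e∈D))
    from-tiles : a ∈ tileSides → canonical (proj₂ a) ≡ true × IsEdge a
    from-tiles a∈tileSides =
      let (st , _ , a∈cellSides) = find (Anyₚ.concatMap⁻ cellSides {xs = T} a∈tileSides)
          (h , _ , a∈sides) = find (Anyₚ.concatMap⁻ (sides ∘ center) {xs = cells (proj₂ st)} a∈cellSides)
      in sides-canonical (center h) a∈sides , sides-edges h a∈sides

  ⨁-boundary : ∀ (f : Step → Bool) →
    ⨁[ e ∈ D ] f (canon e) ≡ ⨁[ st ∈ T ] ⨁[ h ∈ cells (proj₂ st) ] ⨁[ σ ∈ sides (center h) ] f σ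
  ⨁-boundary f = begin
    ⨁[ e ∈ D ] f (canon e)  ≡⟨ ⨁-map canon D f ⟨
    ⨁ (map canon D) f       ≡⟨ Mˢ.⨁-odd-cong (map canon D) tileSides same-odd f ⟩
    ⨁ tileSides f           ≡⟨ ⨁-tileSides f ⟩
    ⨁[ st ∈ T ] ⨁[ h ∈ cells (proj₂ st) ] ⨁[ σ ∈ sides (center h) ] f σ ∎
    where
    open ≡-Reasoning
    same-odd : ∀ a → a ∈ map canon D ++ tileSides → Mˢ.odd (map canon D) a ≡ Mˢ.odd tileSides a
    same-odd a a∈ = let (a-canonical , a-edge) = canonical-edge a∈ in
      trans (odd-canon-boundary a a-canonical a-edge) (sym (odd-tileSides a a-canonical))

boundary-klein : ∀ {R v ds T} → CCWBoundary R v ds → IsSignedTiling R T →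
  klein (walkLabel v ds) ≡ 0ᴷ
boundary-klein {v = v} {ds} {T} ∂R tiling = begin
  klein (walkLabel v ds)
    ≡⟨ klein-walkLabel v ds ⟩
  ⨁ᴷ[ e ∈ D ] klein (label e)
    ≡⟨ ⨁ᴷ-cong D (λ {e} _ → trans (klein-label e) (sym (κ-canon e))) ⟩
  ⨁ᴷ[ e ∈ D ] κ (canon e)
    ≡⟨ cong₂ _,_ (⨁-boundary (proj₁ ∘ κ)) (⨁-boundary (proj₂ ∘ κ)) ⟩
  ⨁ᴷ[ st ∈ T ] ⨁ᴷ[ h ∈ cells (proj₂ st) ] ⨁ᴷ[ σ ∈ sides (center h) ] κ σ
    ≡⟨ ⨁ᴷ-cong T (λ {st} _ → ⨁ᴷ-cong (cells (proj₂ st)) (λ {h} _ → hexagon-κ (center h))) ⟩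
  ⨁ᴷ[ st ∈ T ] ⨁ᴷ[ h ∈ cells (proj₂ st) ] klein (ι (colour h))
    ≡⟨ ⨁ᴷ-cong T (λ {st} _ → tile-κ (proj₂ st)) ⟩
  ⨁ᴷ[ st ∈ T ] 0ᴷ
    ≡⟨ ⨁ᴷ-zero T ⟩
  0ᴷ ∎
  where
  open ≡-Reasoning
  open Boundary ∂R {T} tiling

±I-cases : ∀ {M} s → M ≡ ±I s → (M ≡ I) ⊎ (M ≡ -I)
±I-cases false = inj₁
±I-cases true  = inj₂

mainTheorem2 : (R : List Hex) → Connected R → SimplyConnected R →
    (v : Pt) (ds : List Dir) → CCWBoundary R v ds →
    SignedTilable R → (walkMat ds ≡ I) ⊎ (walkMat ds ≡ -I)
mainTheorem2 R _ _ (x , y) ds ∂R (T , tiling) =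
  ±I-cases s (conjugate-±I (walkMat ds) (mod3 x) (mod3 y) s gauged)
  where
  open CCWBoundary ∂R using (closed)
  open Boundary ∂R {T} tiling using (D-edge)
  s = proj₁ (walkLabel (x , y) ds)
  label≡ : walkLabel (x , y) ds ≡ (s , false , false)
  label≡ = cong (s ,_) (boundary-klein {T = T} ∂R tiling)
  gauged : walkMat ds · gauge (mod3 x) (mod3 y) ≡ gauge (mod3 x) (mod3 y) · ρ (s , false , false)
  gauged = subst (λ G → walkMat ds · G ≡ G · ρ (s , false , false)) (gaugeAt-def x y)
    (subst₂ (λ w q → walkMat ds · gaugeAt (x , y) ≡ gaugeAt w · ρ q) closed label≡
      (walk-gauge (x , y) ds D-edge))
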